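{- Let $G$ and $H$ be connected bipartite graphs with $G \approx H$ (neighbourhood size equivalent). Then for all positive integers $p$ and $q$, $|\mathrm{Hom}(G,B_{p,q})| = |\mathrm{Hom}(H,B_{p,q})|$ and the number of surjective homomorphisms from $G$ to $B_{p,q}$ equals the number of surjective homomorphisms from $H$ to $B_{p,q}$.
   Context: All graphs are finite, simple and undirected. $\mathrm{Hom}(G,H)$ is the set of homomorphisms; a surjective homomorphism is one whose vertex map is onto. $B_{p,q}$ is the tree with two adjacent vertices $u,v$, where $u$ has $p$ further neighbours that are leaves and $v$ has $q$ further neighbours that are leaves (so $B_{p,q}$ has $p+q+2$ vertices). For a vertex set $S$, $N(S)$ is the set of vertices adjacent to some vertex of $S$. Two connected bipartite graphs $G,H$ (with at least two vertices) are neighbourhood size equivalent, $G\approx H$, if there are bipartitions $(X^G,Y^G)$ of $G$ and $(X^H,Y^H)$ of $H$ with $|X^G|\le|Y^G|$, $|X^H|\le|Y^H|$, $|X^G|=|X^H|$, $|Y^G|=|Y^H|$, and a bijection $\eta$ from the power set of $X^G$ to the power set of $X^H$ such that for every $S\subseteq X^G$: $|\eta(S)|=|S|$ and $|N(\eta(S))| = |N(S)|$. -}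

module Defs where

open import Data.Nat using (ℕ; zero; suc; _+_; _≤_; _≡ᵇ_; _<ᵇ_)
open import Data.Bool using (Bool; true; false; _∧_; _∨_; not; if_then_else_)
open import Data.Fin using (Fin; toℕ)
open import Data.Fin.Subset using (Subset; _⊆_; ∁; ∣_∣)
open import Data.Vec using (Vec; []; _∷_; lookup; tabulate)
open import Data.List using (List; []; _∷_; map; concatMap; allFin; length; filterᵇ)
open import Data.Bool.ListAction using (all; any)
open import Data.Product using (Σ; ∃; _×_; _,_)
open import Relation.Binary.PropositionalEquality using (_≡_)

record Graph : Set where
  field
    n      : ℕ
    adj    : Fin n → Fin n → Bool
    sym    : ∀ i j → adj i j ≡ adj j i
    irrefl : ∀ i → adj i i ≡ false
open Graph public

_==_ : ∀ {m} → Fin m → Fin m → Bool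
a == b = toℕ a ≡ᵇ toℕ b

data Reach (G : Graph) : Fin (n G) → Fin (n G) → Set where
  here : ∀ {u} → Reach G u u
  step : ∀ {u w v} → adj G u w ≡ true → Reach G w v → Reach G u v

Connected : Graph → Set
Connected G = ∀ u v → Reach G u v

N : (G : Graph) → Subset (n G) → Subset (n G)
N G S = tabulate (λ v → any (λ u → lookup S u ∧ adj G u v) (allFin (n G)))

IsBipartition : (G : Graph) → Subset (n G) → Set
IsBipartition G X = ∀ u v → adj G u v ≡ true → lookup X u ≡ not (lookup X v)

-- The bijection η : P(X^G) → P(X^H) is represented by a function on all
-- subsets which maps subsets of X^G into subsets of X^H and is bijective
-- between these two power sets.
record NSEquiv (G H : Graph) : Set where
  field
    XG   : Subset (n G)
    XH   : Subset (n H)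
    bipG : IsBipartition G XG
    bipH : IsBipartition H XH
    smallG : ∣ XG ∣ ≤ ∣ ∁ XG ∣
    smallH : ∣ XH ∣ ≤ ∣ ∁ XH ∣
    sameX  : ∣ XG ∣ ≡ ∣ XH ∣
    sameY  : ∣ ∁ XG ∣ ≡ ∣ ∁ XH ∣
    η      : Subset (n G) → Subset (n H)
    η-into : ∀ S → S ⊆ XG → η S ⊆ XH
    η-inj  : ∀ S T → S ⊆ XG → T ⊆ XG → η S ≡ η T → S ≡ T
    η-surj : ∀ T → T ⊆ XH → Σ (Subset (n G)) (λ S → S ⊆ XG × η S ≡ T)
    η-size : ∀ S → S ⊆ XG → ∣ η S ∣ ≡ ∣ S ∣
    η-nbhd : ∀ S → S ⊆ XG → ∣ N H (η S) ∣ ≡ ∣ N G S ∣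

_≈_ : Graph → Graph → Set
G ≈ H = NSEquiv G H

-- The double star B_{p,q} on Fin (p + q + 2):
-- vertex 0 = u, vertex 1 = v, vertices 2..p+1 are the leaves at u,
-- vertices p+2..p+q+1 are the leaves at v.
private
  arc : ℕ → ℕ → ℕ → Bool
  arc p a b = ((a ≡ᵇ 0) ∧ (b ≡ᵇ 1))
            ∨ ((a ≡ᵇ 0) ∧ ((1 <ᵇ b) ∧ (b <ᵇ p + 2)))
            ∨ ((a ≡ᵇ 1) ∧ (p + 1 <ᵇ b))

Badj : ∀ p q → Fin (p + q + 2) → Fin (p + q + 2) → Bool
Badj p q i j = arc p (toℕ i) (toℕ j) ∨ arc p (toℕ j) (toℕ i)

allMaps : ∀ n m → List (Vec (Fin m) n)
allMaps zero m = [] ∷ []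
allMaps (suc n) m = concatMap (λ x → map (x ∷_) (allMaps n m)) (allFin m)

isHom : (G : Graph) → ∀ {m} → (Fin m → Fin m → Bool) → Vec (Fin m) (n G) → Bool
isHom G A f = all (λ i → all (λ j → not (adj G i j) ∨ A (lookup f i) (lookup f j))
                             (allFin (n G))) (allFin (n G))

isSurj : ∀ {k m} → Vec (Fin m) k → Bool
isSurj {k} {m} f = all (λ b → any (λ a → lookup f a == b) (allFin k)) (allFin m)

homCountB : Graph → ℕ → ℕ → ℕ
homCountB G p q = length (filterᵇ (isHom G (Badj p q)) (allMaps (n G) (p + q + 2)))

surjHomCountB : Graph → ℕ → ℕ → ℕ
surjHomCountB G p q =
  length (filterᵇ (λ f → isHom G (Badj p q) f ∧ isSurj f) (allMaps (n G) (p + q + 2)))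

{-# OPTIONS --safe #-}
-- Collapsing the leaves at u and at v turns B_{p,q} into the path leaf – u – v – leaf. A homomorphism
-- f : G → B_{p,q} therefore sends the colour class X of the connected bipartite graph G into one side of
-- that path, say into {u} ∪ leaves(v). If R ⊆ X is the set of vertices sent to leaves, then f maps X ∖ R
-- to u, N(R) to v, and Y ∖ N(R) to neighbours of u. In H the four sets η(R), X^H ∖ η(R), N(η(R)) and
-- Y^H ∖ N(η(R)) have the same sizes as R, X ∖ R, N(R) and Y ∖ N(R). Copying the values of f region by
-- region, in vertex order, therefore gives a homomorphism H → B_{p,q} with the same image. The copy
-- determines η(R) and hence R, so copying is injective. The inverse of η gives the injection the
-- other way.
module Submission where

open import Defs
open import Data.Nat using (ℕ; suc; _≤_; _≥_)
open import Data.Product using (_×_)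
open import Relation.Binary.PropositionalEquality using (_≡_)

open import Data.Nat using (zero; _+_; _∸_; _<ᵇ_; _≡ᵇ_; z≤n; s≤s)
open import Data.Nat.Properties
  using (+-suc; +-comm; suc-injective; m+n∸m≡n; ≤-trans; ≤-reflexive; ≤-antisym; ≡ᵇ⇒≡; ≡⇒≡ᵇ)
open import Data.Bool using (Bool; true; false; not; _∧_; _∨_; _xor_; if_then_else_; T)
import Data.Bool as Bool
open import Data.Bool.Properties using (T-≡; not-injective; T-∧; xor-comm; not-involutive)
open import Data.Bool.ListAction using (all; any)
open import Data.Fin using (Fin; zero; suc; toℕ; _↑ʳ_; fromℕ<)
open import Data.Fin.Properties using (toℕ-injective)
open import Data.Fin.Subset using (Subset; _⊆_; ∁; ∣_∣)
open import Data.Fin.Subset.Properties using (drop-∷-⊆; _⊆?_)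
open import Data.Vec as Vec using (Vec; []; _∷_; lookup; tabulate; here)
open import Data.Vec.Properties
  using (lookup∘tabulate; tabulate∘lookup; tabulate-cong; []=⇒lookup; lookup⇒[]=; lookup-map; ∷-injective)
open import Data.List
  using (List; []; _∷_; length; map; allFin; filterᵇ; _++_; cartesianProductWith; concatMap)
open import Data.List.Properties using (∷-injectiveˡ; ∷-injectiveʳ; length-map; length-++)
open import Data.List.Membership.Propositional using (_∈_; lose)
open import Data.List.Membership.Propositional.Properties
  using ( ∈-allFin; ∈-map⁻; ∈-filter⁺; ∈-filter⁻; ∈-∃++; ∈-++⁻; ∈-++⁺ˡ; ∈-++⁺ʳ
        ; ∈-cartesianProductWith⁺)
open import Data.List.Relation.Unary.All as All using (All; []; _∷_)
open import Data.List.Relation.Unary.Any using (here; there; satisfied)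
open import Data.List.Relation.Unary.Any.Properties using (any⁺; any⁻)
open import Data.List.Relation.Unary.Unique.Propositional using (Unique; []; _∷_)
import Data.List.Relation.Unary.Unique.Propositional.Properties as Unique
open import Data.Product using (∃; _,_; proj₁; proj₂)
open import Data.Product.Properties using (≡-dec; ,-injectiveʳ)
open import Data.Sum using (inj₁; inj₂)
open import Data.Unit using (tt)
open import Data.Empty using (⊥-elim)
open import Function using (_∘_; Equivalence)
open import Relation.Binary.Definitions using (DecidableEquality)
open import Relation.Nullary using (yes; no; does; contradiction)
open import Relation.Nullary.Decidable using (dec-true; dec-false; T?)
open import Relation.Binary.PropositionalEquality as ≡
  using (_≢_; refl; trans; cong; cong₂; subst; subst₂)

private variable
  m k : ℕ
  A : Set

module Relabelling {L : Set} (_≟_ : DecidableEquality L) where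

  count : L → Vec L m → ℕ
  count l = Vec.count (_≟ l)

  count-∷-≡ : ∀ l (β : Vec L m) → count l (l ∷ β) ≡ suc (count l β)
  count-∷-≡ l β rewrite dec-true (l ≟ l) refl = refl

  count-∷-≢ : ∀ {b l} (β : Vec L m) → b ≢ l → count l (b ∷ β) ≡ count l β
  count-∷-≢ {b = b} {l} β b≢l rewrite dec-false (b ≟ l) b≢l = refl

  pick : L → Vec L m → Vec A m → List A
  pick l [] [] = []
  pick l (b ∷ β) (x ∷ v) with b ≟ l
  ... | yes _ = x ∷ pick l β v
  ... | no _ = pick l β v

  length-pick : ∀ l (β : Vec L m) (v : Vec A m) → length (pick l β v) ≡ count l β
  length-pick l [] [] = refl
  length-pick l (b ∷ β) (x ∷ v) with b ≟ l
  ... | yes _ = cong suc (length-pick l β v)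
  ... | no _ = length-pick l β v

  pick-∈ : ∀ (β : Vec L m) (v : Vec A m) i → lookup v i ∈ pick (lookup β i) β v
  pick-∈ (b ∷ β) (x ∷ v) zero with b ≟ b
  ... | yes _ = here refl
  ... | no b≢b = contradiction refl b≢b
  pick-∈ (b ∷ β) (x ∷ v) (suc i) with b ≟ lookup β i
  ... | yes _ = there (pick-∈ β v i)
  ... | no _ = pick-∈ β v i

  ∈-pick : ∀ {l x} (β : Vec L m) (v : Vec A m) → x ∈ pick l β v →
           ∃ λ i → lookup β i ≡ l × lookup v i ≡ x
  ∈-pick [] [] ()
  ∈-pick {l = l} (b ∷ β) (y ∷ v) x∈ with b ≟ l | x∈
  ... | yes b≡l | here refl = zero , b≡l , refl
  ... | yes _ | there x∈′ = let i , βi≡l , vi≡x = ∈-pick β v x∈′ in suc i , βi≡l , vi≡x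
  ... | no _    | x∈′       = let i , βi≡l , vi≡x = ∈-pick β v x∈′ in suc i , βi≡l , vi≡x

  pick-injective : ∀ (β : Vec L m) {u v : Vec A m} →
                   (∀ l → pick l β u ≡ pick l β v) → u ≡ v
  pick-injective [] {[]} {[]} _ = refl
  pick-injective (b ∷ β) {x ∷ u} {y ∷ v} same = cong₂ _∷_ heads (pick-injective β tails)
    where
    heads : x ≡ y
    heads with b ≟ b | same b
    ... | yes _ | eq = ∷-injectiveˡ eq
    ... | no b≢b | _ = contradiction refl b≢b
    tails : ∀ l → pick l β u ≡ pick l β v
    tails l with b ≟ l | same l
    ... | yes _ | eq = ∷-injectiveʳ eq
    ... | no _ | eq = eq

  pick-matching : ∀ (β : Vec L m) (β′ : Vec L k) {u : Vec A m} {u′ : Vec A k} →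
                  (∀ l → pick l β u ≡ pick l β′ u′) →
                  ∀ j → ∃ λ i → lookup β i ≡ lookup β′ j × lookup u i ≡ lookup u′ j
  pick-matching β β′ {u} {u′} same j =
    ∈-pick β u (subst (lookup u′ j ∈_) (≡.sym (same (lookup β′ j))) (pick-∈ β′ u′ j))

  replace : L → List A → (L → List A) → L → List A
  replace l xs qs l′ = if does (l′ ≟ l) then xs else qs l′

  replace-≡ : ∀ l (xs : List A) qs → replace l xs qs l ≡ xs
  replace-≡ l xs qs rewrite dec-true (l ≟ l) refl = refl

  replace-≢ : ∀ {l l′} (xs : List A) qs → l′ ≢ l → replace l xs qs l′ ≡ qs l′
  replace-≢ {l = l} {l′ = l′} xs qs l′≢l rewrite dec-false (l′ ≟ l) l′≢l = refl

  -- The default a is only used when a queue runs out, which the hypothesis of pick-place excludes.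
  place : A → Vec L m → (L → List A) → Vec A m
  place a [] qs = []
  place a (l ∷ β) qs with qs l
  ... | [] = a ∷ place a β qs
  ... | x ∷ xs = x ∷ place a β (replace l xs qs)

  pick-place : ∀ {A : Set} (a : A) (β : Vec L m) qs → (∀ l → length (qs l) ≡ count l β) →
               ∀ l → pick l β (place a β qs) ≡ qs l
  pick-place a [] qs lengths l with qs l | lengths l
  ... | [] | _ = refl
  pick-place {A = A} a (b ∷ β) qs lengths l with qs b in qs-b | lengths b
  ... | [] | length-b = contradiction (trans length-b (count-∷-≡ b β)) λ ()
  ... | x ∷ xs | length-b = shift
    where
    qs′ : L → List A
    qs′ = replace b xs qs
    lengths′ : ∀ l′ → length (qs′ l′) ≡ count l′ β
    lengths′ l′ with l′ ≟ b
    ... | yes refl = suc-injective (trans length-b (count-∷-≡ b β))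
    ... | no l′≢b = trans (lengths l′) (count-∷-≢ β (l′≢b ∘ ≡.sym))
    shift : pick l (b ∷ β) (x ∷ place a β qs′) ≡ qs l
    shift with b ≟ l
    ... | yes refl =
      trans (cong (x ∷_) (trans (pick-place a β qs′ lengths′ b) (replace-≡ b xs qs))) (≡.sym qs-b)
    ... | no b≢l = trans (pick-place a β qs′ lengths′ l) (replace-≢ xs qs (b≢l ∘ ≡.sym))

  -- When β and β′ have the same label counts, relabel copies v along the order-preserving bijection
  -- between the positions carrying each label.
  relabel : A → Vec L m → Vec L k → Vec A m → Vec A k
  relabel a β β′ v = place a β′ (λ l → pick l β v)

  module _ (a : A) (β : Vec L m) (β′ : Vec L k)
           (same-counts : ∀ l → count l β ≡ count l β′) where

    pick-relabel : ∀ v l → pick l β′ (relabel a β β′ v) ≡ pick l β v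
    pick-relabel v = pick-place a β′ _ (λ l → trans (length-pick l β v) (same-counts l))

    relabel-injective : ∀ {u v} → relabel a β β′ u ≡ relabel a β β′ v → u ≡ v
    relabel-injective {u} {v} eq = pick-injective β λ l →
      trans (≡.sym (pick-relabel u l)) (trans (cong (pick l β′) eq) (pick-relabel v l))

    relabel-from : ∀ v j → ∃ λ i → lookup β i ≡ lookup β′ j ×
                                   lookup v i ≡ lookup (relabel a β β′ v) j
    relabel-from v = pick-matching β β′ (≡.sym ∘ pick-relabel v)

    relabel-onto : ∀ v i → ∃ λ j → lookup β′ j ≡ lookup β i ×
                                   lookup (relabel a β β′ v) j ≡ lookup v i
    relabel-onto v = pick-matching β′ β (pick-relabel v)

_≟²_ : DecidableEquality (Bool × Bool)
_≟²_ = ≡-dec Bool._≟_ Bool._≟_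

open Relabelling _≟²_

-- Labels the four regions R, X ∖ R, S and ∁ X ∖ S, for R ⊆ X and S ⊆ ∁ X.
region : Bool → Bool → Bool → Bool × Bool
region x r s = x , (if x then r else s)

regions : Subset m → Subset m → Subset m → Vec (Bool × Bool) m
regions X R S = tabulate λ i → region (lookup X i) (lookup R i) (lookup S i)

regions-inside : ∀ (X R S : Subset m) {i} → lookup X i ≡ true →
                 lookup (regions X R S) i ≡ (true , lookup R i)
regions-inside X R S {i} Xi =
  trans (lookup∘tabulate _ i) (cong (λ x → region x (lookup R i) (lookup S i)) Xi)

regions-outside : ∀ (X R S : Subset m) {i} → lookup X i ≡ false →
                  lookup (regions X R S) i ≡ (false , lookup S i)
regions-outside X R S {i} Xi =
  trans (lookup∘tabulate _ i) (cong (λ x → region x (lookup R i) (lookup S i)) Xi)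

regions-true⁻ : ∀ (X R S : Subset m) {i b} → lookup (regions X R S) i ≡ (true , b) →
                lookup X i ≡ true × lookup R i ≡ b
regions-true⁻ X R S {i} {b} eq = match (lookup X i) refl
  where
  match : ∀ x → lookup X i ≡ x → lookup X i ≡ true × lookup R i ≡ b
  match true Xi = Xi , ,-injectiveʳ (trans (≡.sym (regions-inside X R S Xi)) eq)
  match false Xi with () ← trans (≡.sym (regions-outside X R S Xi)) eq

count-regions-R : ∀ (X R S : Subset m) → R ⊆ X → count (true , true) (regions X R S) ≡ ∣ R ∣
count-regions-R [] [] [] _ = refl
count-regions-R (x ∷ X) (true ∷ R) (s ∷ S) R⊆X with R⊆X here
... | here = cong suc (count-regions-R X R S (drop-∷-⊆ R⊆X))
count-regions-R (true ∷ X) (false ∷ R) (s ∷ S) R⊆X = count-regions-R X R S (drop-∷-⊆ R⊆X)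
count-regions-R (false ∷ X) (false ∷ R) (s ∷ S) R⊆X = count-regions-R X R S (drop-∷-⊆ R⊆X)

count-regions-S : ∀ (X R S : Subset m) → S ⊆ ∁ X → count (false , true) (regions X R S) ≡ ∣ S ∣
count-regions-S [] [] [] _ = refl
count-regions-S (true ∷ X) (r ∷ R) (true ∷ S) S⊆∁X with S⊆∁X here
... | ()
count-regions-S (false ∷ X) (r ∷ R) (true ∷ S) S⊆∁X =
  cong suc (count-regions-S X R S (drop-∷-⊆ S⊆∁X))
count-regions-S (true ∷ X) (r ∷ R) (false ∷ S) S⊆∁X = count-regions-S X R S (drop-∷-⊆ S⊆∁X)
count-regions-S (false ∷ X) (r ∷ R) (false ∷ S) S⊆∁X = count-regions-S X R S (drop-∷-⊆ S⊆∁X)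

count-regions-inside : ∀ (X R S : Subset m) →
                       count (true , true) (regions X R S) + count (true , false) (regions X R S) ≡ ∣ X ∣
count-regions-inside [] [] [] = refl
count-regions-inside (true ∷ X) (true ∷ R) (s ∷ S) = cong suc (count-regions-inside X R S)
count-regions-inside (true ∷ X) (false ∷ R) (s ∷ S) =
  trans (+-suc _ _) (cong suc (count-regions-inside X R S))
count-regions-inside (false ∷ X) (r ∷ R) (s ∷ S) = count-regions-inside X R S

count-regions-outside : ∀ (X R S : Subset m) →
                        count (false , true) (regions X R S) + count (false , false) (regions X R S) ≡ ∣ ∁ X ∣
count-regions-outside [] [] [] = refl
count-regions-outside (false ∷ X) (r ∷ R) (true ∷ S) = cong suc (count-regions-outside X R S)
count-regions-outside (false ∷ X) (r ∷ R) (false ∷ S) =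
  trans (+-suc _ _) (cong suc (count-regions-outside X R S))
count-regions-outside (true ∷ X) (r ∷ R) (s ∷ S) = count-regions-outside X R S

regionSize : Subset m → Subset m → Subset m → Bool × Bool → ℕ
regionSize X R S (true , true) = ∣ R ∣
regionSize X R S (true , false) = ∣ X ∣ ∸ ∣ R ∣
regionSize X R S (false , true) = ∣ S ∣
regionSize X R S (false , false) = ∣ ∁ X ∣ ∸ ∣ S ∣

count-regions : ∀ (X R S : Subset m) → R ⊆ X → S ⊆ ∁ X →
                ∀ l → count l (regions X R S) ≡ regionSize X R S l
count-regions X R S R⊆X S⊆∁X (true , true) = count-regions-R X R S R⊆X
count-regions X R S R⊆X S⊆∁X (false , true) = count-regions-S X R S S⊆∁X
count-regions X R S R⊆X S⊆∁X (true , false) =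
  trans (≡.sym (m+n∸m≡n (count (true , true) (regions X R S)) _))
        (cong₂ _∸_ (count-regions-inside X R S) (count-regions-R X R S R⊆X))
count-regions X R S R⊆X S⊆∁X (false , false) =
  trans (≡.sym (m+n∸m≡n (count (false , true) (regions X R S)) _))
        (cong₂ _∸_ (count-regions-outside X R S) (count-regions-S X R S S⊆∁X))

-- hub false is u, hub true is v and leaf c is a leaf on hub c: B_{p,q} collapses onto the path
-- leaf false – hub false – hub true – leaf true (Badj-role), whose bipartition is side.
data Role : Set where
  hub leaf : Bool → Role

roleAdj : Role → Role → Bool
roleAdj (hub c) (hub c′) = c xor c′
roleAdj (hub c) (leaf c′) = not (c xor c′)
roleAdj (leaf c) (hub c′) = not (c xor c′)
roleAdj (leaf _) (leaf _) = false

side : Role → Bool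
side (hub c) = c
side (leaf c) = not c

isLeaf : Role → Bool
isLeaf (hub _) = false
isLeaf (leaf _) = true

roleAdj-sym : ∀ r r′ → roleAdj r r′ ≡ roleAdj r′ r
roleAdj-sym (hub c) (hub c′) = xor-comm c c′
roleAdj-sym (hub c) (leaf c′) = cong not (xor-comm c c′)
roleAdj-sym (leaf c) (hub c′) = cong not (xor-comm c c′)
roleAdj-sym (leaf _) (leaf _) = refl

roleAdj⇒side : ∀ r r′ → roleAdj r r′ ≡ true → side r ≡ not (side r′)
roleAdj⇒side (hub false) (hub true) _ = refl
roleAdj⇒side (hub true) (hub false) _ = refl
roleAdj⇒side (hub false) (leaf false) _ = refl
roleAdj⇒side (hub true) (leaf true) _ = refl
roleAdj⇒side (leaf false) (hub false) _ = refl
roleAdj⇒side (leaf true) (hub true) _ = refl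
roleAdj⇒side (hub false) (hub false) ()
roleAdj⇒side (hub true) (hub true) ()
roleAdj⇒side (hub false) (leaf true) ()
roleAdj⇒side (hub true) (leaf false) ()
roleAdj⇒side (leaf false) (hub true) ()
roleAdj⇒side (leaf true) (hub false) ()
roleAdj⇒side (leaf _) (leaf _) ()

leaf-of-side : ∀ c r → isLeaf r ≡ true → not (side r) ≡ c → r ≡ leaf c
leaf-of-side c (leaf false) _ refl = refl
leaf-of-side c (leaf true) _ refl = refl

hub-of-side : ∀ c r → isLeaf r ≡ false → not (side r) ≡ c → r ≡ hub (not c)
hub-of-side c (hub false) _ refl = refl
hub-of-side c (hub true) _ refl = refl

leaf-neighbour : ∀ c r → roleAdj (leaf c) r ≡ true → r ≡ hub c
leaf-neighbour false (hub false) _ = refl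
leaf-neighbour true (hub true) _ = refl
leaf-neighbour false (hub true) ()
leaf-neighbour true (hub false) ()

hub-neighbour : ∀ c r → side r ≡ c → roleAdj (hub (not c)) r ≡ true
hub-neighbour false (hub false) refl = refl
hub-neighbour true (hub true) refl = refl
hub-neighbour false (leaf true) refl = refl
hub-neighbour true (leaf false) refl = refl

roleℕ : ℕ → ℕ → Role
roleℕ p zero = hub false
roleℕ p (suc zero) = hub true
roleℕ p (suc (suc k)) = leaf (not (k <ᵇ p))

role : ∀ p {q} → Fin (p + q + 2) → Role
role p x = roleℕ p (toℕ x)

-- A verbatim copy of the arc relation that Defs keeps private, so that Badj unfolds to it.
doubleStarArc : ℕ → ℕ → ℕ → Bool
doubleStarArc p a b = ((a ≡ᵇ 0) ∧ (b ≡ᵇ 1))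
                    ∨ ((a ≡ᵇ 0) ∧ ((1 <ᵇ b) ∧ (b <ᵇ p + 2)))
                    ∨ ((a ≡ᵇ 1) ∧ (p + 1 <ᵇ b))

<ᵇ-+2 : ∀ p k → (suc (suc k) <ᵇ p + 2) ≡ (k <ᵇ p)
<ᵇ-+2 p k rewrite +-comm p 2 = refl

+1-<ᵇ : ∀ p k → (p + 1 <ᵇ suc (suc k)) ≡ not (k <ᵇ p)
+1-<ᵇ p k rewrite +-comm p 1 = flip p k
  where
  flip : ∀ p k → (p <ᵇ suc k) ≡ not (k <ᵇ p)
  flip zero k = refl
  flip (suc p) zero = refl
  flip (suc p) (suc k) = flip p k

doubleStarArc-role : ∀ p a b →
                     (doubleStarArc p a b ∨ doubleStarArc p b a) ≡ roleAdj (roleℕ p a) (roleℕ p b)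
doubleStarArc-role p zero zero = refl
doubleStarArc-role p zero (suc zero) = refl
doubleStarArc-role p (suc zero) zero = refl
doubleStarArc-role p (suc zero) (suc zero) rewrite +-comm p 1 = refl
doubleStarArc-role p zero (suc (suc l)) rewrite <ᵇ-+2 p l with l <ᵇ p
... | true = refl
... | false = refl
doubleStarArc-role p (suc (suc k)) zero rewrite <ᵇ-+2 p k with k <ᵇ p
... | true = refl
... | false = refl
doubleStarArc-role p (suc zero) (suc (suc l)) rewrite +1-<ᵇ p l with l <ᵇ p
... | true = refl
... | false = refl
doubleStarArc-role p (suc (suc k)) (suc zero) rewrite +1-<ᵇ p k with k <ᵇ p
... | true = refl
... | false = refl
doubleStarArc-role p (suc (suc k)) (suc (suc l)) = refl

Badj-role : ∀ p q (x y : Fin (p + q + 2)) → Badj p q x y ≡ roleAdj (role p x) (role p y)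
Badj-role p q x y = doubleStarArc-role p (toℕ x) (toℕ y)

all⁺ : ∀ (P : A → Bool) xs → All (T ∘ P) xs → T (all P xs)
all⁺ P [] [] = tt
all⁺ P (x ∷ xs) (px ∷ pxs) = Equivalence.from T-∧ (px , all⁺ P xs pxs)

all⁻ : ∀ (P : A → Bool) xs → T (all P xs) → All (T ∘ P) xs
all⁻ P [] _ = []
all⁻ P (x ∷ xs) t = let px , pxs = Equivalence.to T-∧ t in px ∷ all⁻ P xs pxs

==⇒≡ : ∀ (a b : Fin m) → T (a == b) → a ≡ b
==⇒≡ a b t = toℕ-injective (≡ᵇ⇒≡ (toℕ a) (toℕ b) t)

==-refl : ∀ (a : Fin m) → T (a == a)
==-refl a = ≡⇒≡ᵇ (toℕ a) (toℕ a) refl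

IsHom : (G : Graph) → (Fin m → Fin m → Bool) → Vec (Fin m) (n G) → Set
IsHom G E f = ∀ i j → adj G i j ≡ true → E (lookup f i) (lookup f j) ≡ true

IsSurj : Vec (Fin m) k → Set
IsSurj {m} {k} f = ∀ (b : Fin m) → ∃ λ (a : Fin k) → lookup f a ≡ b

module _ (G : Graph) (E : Fin m → Fin m → Bool) (f : Vec (Fin m) (n G)) where

  private
    edgeOK : Fin (n G) → Fin (n G) → Bool
    edgeOK i j = not (adj G i j) ∨ E (lookup f i) (lookup f j)

    rowOK : Fin (n G) → Bool
    rowOK i = all (edgeOK i) (allFin (n G))

  isHom⁺ : IsHom G E f → T (isHom G E f)
  isHom⁺ hom = all⁺ rowOK (allFin (n G)) (All.tabulate λ {i} _ → row i)
    where
    edge : ∀ i j → T (edgeOK i j)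
    edge i j with adj G i j in ij
    ... | true = Equivalence.from T-≡ (hom i j ij)
    ... | false = tt
    row : ∀ i → T (rowOK i)
    row i = all⁺ (edgeOK i) (allFin (n G)) (All.tabulate λ {j} _ → edge i j)

  isHom⁻ : T (isHom G E f) → IsHom G E f
  isHom⁻ t i j ij =
    Equivalence.to T-≡ (subst (λ a → T (not a ∨ E (lookup f i) (lookup f j))) ij edge)
    where
    edge : T (edgeOK i j)
    edge = All.lookup (all⁻ (edgeOK i) _ (All.lookup (all⁻ rowOK _ t) (∈-allFin i))) (∈-allFin j)

module _ (f : Vec (Fin m) k) where

  private
    hits : Fin m → Bool
    hits b = any (λ a → lookup f a == b) (allFin k)

  isSurj⁺ : IsSurj f → T (isSurj f)
  isSurj⁺ onto = all⁺ hits (allFin m) (All.tabulate λ {b} _ → hit b (onto b))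
    where
    hit : ∀ b → (∃ λ a → lookup f a ≡ b) → T (hits b)
    hit b (a , refl) = any⁺ _ (lose (∈-allFin a) (==-refl (lookup f a)))

  isSurj⁻ : T (isSurj f) → IsSurj f
  isSurj⁻ t b =
    let a , fa==b = satisfied (any⁻ _ (allFin k) (All.lookup (all⁻ hits _ t) (∈-allFin b)))
    in a , ==⇒≡ _ _ fa==b

N-elim : ∀ (G : Graph) S {v} → lookup (N G S) v ≡ true →
         ∃ λ u → lookup S u ≡ true × adj G u v ≡ true
N-elim G S {v} Nv =
  let u , Su∧uv = satisfied (any⁻ _ (allFin (n G)) (Equivalence.from T-≡ (trans (≡.sym (lookup∘tabulate _ v)) Nv)))
      Su , uv = Equivalence.to T-∧ Su∧uv
  in u , Equivalence.to T-≡ Su , Equivalence.to T-≡ uv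

N-intro : ∀ (G : Graph) S {u v} → lookup S u ≡ true → adj G u v ≡ true → lookup (N G S) v ≡ true
N-intro G S {u} {v} Su uv = trans (lookup∘tabulate _ v) (Equivalence.to T-≡ (any⁺ _ (lose (∈-allFin u) Su∧uv)))
  where
  Su∧uv : T (lookup S u ∧ adj G u v)
  Su∧uv = Equivalence.from T-∧ (Equivalence.from T-≡ Su , Equivalence.from T-≡ uv)

IsRoleHom : (G : Graph) → (Fin (n G) → Role) → Set
IsRoleHom G ρ = ∀ i j → adj G i j ≡ true → roleAdj (ρ i) (ρ j) ≡ true

leaves : Subset m → (Fin m → Role) → Subset m
leaves X ρ = tabulate λ i → lookup X i ∧ isLeaf (ρ i)

leaves-inside : ∀ X (ρ : Fin m → Role) {i} → lookup X i ≡ true →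
                lookup (leaves X ρ) i ≡ isLeaf (ρ i)
leaves-inside X ρ {i} Xi = trans (lookup∘tabulate _ i) (cong (_∧ isLeaf (ρ i)) Xi)

leaves-outside : ∀ X (ρ : Fin m → Role) {i} → lookup X i ≡ false → lookup (leaves X ρ) i ≡ false
leaves-outside X ρ {i} Xi = trans (lookup∘tabulate _ i) (cong (_∧ isLeaf (ρ i)) Xi)

leaves⊆ : ∀ X (ρ : Fin m → Role) → leaves X ρ ⊆ X
leaves⊆ X ρ {i} i∈ with lookup X i in Xi
... | true = lookup⇒[]= i X Xi
... | false with () ← trans (≡.sym ([]=⇒lookup i∈)) (leaves-outside X ρ Xi)

N⊆∁ : ∀ (G : Graph) {X S} → IsBipartition G X → S ⊆ X → N G S ⊆ ∁ X
N⊆∁ G {X} {S} bip S⊆X {v} v∈ =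
  let u , Su , uv = N-elim G S ([]=⇒lookup v∈)
      Xu = []=⇒lookup (S⊆X (lookup⇒[]= u S Su))
  in lookup⇒[]= v (∁ X) (trans (lookup-map v not X) (trans (≡.sym (bip u v uv)) Xu))

⊆-outside : ∀ {S X : Subset m} {i} → S ⊆ X → lookup X i ≡ false → lookup S i ≡ false
⊆-outside {S = S} {X} {i} S⊆X Xi with lookup S i in Si
... | false = refl
... | true with () ← trans (≡.sym ([]=⇒lookup (S⊆X (lookup⇒[]= i S Si)))) Xi

-- The roles a homomorphism can give each region when the leaves in R hang on hub c, so that X ∖ R
-- goes to the other hub.
Fits : Bool → Bool × Bool → Role → Set
Fits c (true , true) r = r ≡ leaf c
Fits c (true , false) r = r ≡ hub (not c)
Fits c (false , true) r = r ≡ hub c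
Fits c (false , false) r = side r ≡ c

fits-adjacent : ∀ c {m m′ r r′} → Fits c (true , m) r → Fits c (false , m′) r′ →
                (m ≡ true → m′ ≡ true) → roleAdj r r′ ≡ true
fits-adjacent false {true} {true} refl refl _ = refl
fits-adjacent true {true} {true} refl refl _ = refl
fits-adjacent c {true} {false} _ _ marked with () ← marked refl
fits-adjacent false {false} {true} refl refl _ = refl
fits-adjacent true {false} {true} refl refl _ = refl
fits-adjacent c {false} {false} {r′ = r′} refl r′-side _ = hub-neighbour c r′ r′-side

not-xor-not : ∀ x y → not x xor not y ≡ x xor y
not-xor-not false y = not-involutive y
not-xor-not true y = refl

module _ (G : Graph) (X : Subset (n G)) (bip : IsBipartition G X) where

  parity-along : ∀ ρ → IsRoleHom G ρ → ∀ {u v} → Reach G u v →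
                 lookup X u xor side (ρ u) ≡ lookup X v xor side (ρ v)
  parity-along ρ hom here = refl
  parity-along ρ hom (step {u} {w} uw w⇝v) = trans edge (parity-along ρ hom w⇝v)
    where
    edge : lookup X u xor side (ρ u) ≡ lookup X w xor side (ρ w)
    edge = trans (cong₂ _xor_ (bip u w uw) (roleAdj⇒side (ρ u) (ρ w) (hom u w uw)))
                 (not-xor-not (lookup X w) (side (ρ w)))

  module _ (ρ : Fin (n G) → Role) (hom : IsRoleHom G ρ) (c : Bool)
           (parity : ∀ i → lookup X i xor side (ρ i) ≡ c) where

    private
      R : Subset (n G)
      R = leaves X ρ

      side-by-parity : ∀ {i x} → lookup X i ≡ x → x xor side (ρ i) ≡ c
      side-by-parity {i} Xi = trans (cong (_xor side (ρ i)) (≡.sym Xi)) (parity i)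

      fit-inside : ∀ {i} → lookup X i ≡ true → Fits c (true , isLeaf (ρ i)) (ρ i)
      fit-inside {i} Xi with isLeaf (ρ i) in leaf?
      ... | true = leaf-of-side c (ρ i) leaf? (side-by-parity Xi)
      ... | false = hub-of-side c (ρ i) leaf? (side-by-parity Xi)

      in-R : ∀ {u} → lookup R u ≡ true → ρ u ≡ leaf c
      in-R {u} Ru = leaf-of-side c (ρ u) (trans (≡.sym (leaves-inside X ρ Xu)) Ru) (side-by-parity Xu)
        where
        Xu : lookup X u ≡ true
        Xu = []=⇒lookup (leaves⊆ X ρ (lookup⇒[]= u R Ru))

      fit-outside : ∀ {i} → lookup X i ≡ false → Fits c (false , lookup (N G R) i) (ρ i)
      fit-outside {i} Xi with lookup (N G R) i in Ni
      ... | false = side-by-parity Xi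
      ... | true with N-elim G R Ni
      ...   | u , Ru , ui =
        leaf-neighbour c (ρ i) (subst (λ r → roleAdj r (ρ i) ≡ true) (in-R Ru) (hom u i ui))

    leaves-fit : ∀ i → Fits c (lookup (regions X R (N G R)) i) (ρ i)
    leaves-fit i = fit (lookup X i) refl
      where
      fit : ∀ x → lookup X i ≡ x → Fits c (lookup (regions X R (N G R)) i) (ρ i)
      fit true Xi = subst (λ l → Fits c l (ρ i))
        (≡.sym (trans (regions-inside X R (N G R) Xi) (cong (true ,_) (leaves-inside X ρ Xi))))
        (fit-inside Xi)
      fit false Xi = subst (λ l → Fits c l (ρ i)) (≡.sym (regions-outside X R (N G R) Xi))
        (fit-outside Xi)

  module _ (c : Bool) (R : Subset (n G)) (ρ : Fin (n G) → Role)
           (fits : ∀ j → Fits c (lookup (regions X R (N G R)) j) (ρ j)) where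

    private
      from-X : ∀ {j j′} → lookup X j ≡ true → adj G j j′ ≡ true → roleAdj (ρ j) (ρ j′) ≡ true
      from-X {j} {j′} Xj jj′ = fits-adjacent c
        (subst (λ l → Fits c l (ρ j)) (regions-inside X R (N G R) Xj) (fits j))
        (subst (λ l → Fits c l (ρ j′)) (regions-outside X R (N G R) Xj′) (fits j′))
        (λ Rj → N-intro G R Rj jj′)
        where
        Xj′ : lookup X j′ ≡ false
        Xj′ = not-injective (trans (≡.sym (bip j j′ jj′)) Xj)

    fits⇒roleHom : IsRoleHom G ρ
    fits⇒roleHom j j′ jj′ with lookup X j in Xj
    ... | true = from-X Xj jj′
    ... | false = trans (roleAdj-sym (ρ j) (ρ j′)) (from-X (trans (bip j′ j j′j) (cong not Xj)) j′j)
      where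
      j′j : adj G j′ j ≡ true
      j′j = trans (Graph.sym G j′ j) jj′

unique-length-≤ : ∀ {xs ys : List A} → Unique xs → (∀ {x} → x ∈ xs → x ∈ ys) →
                  length xs ≤ length ys
unique-length-≤ {xs = []} _ _ = z≤n
unique-length-≤ {xs = x ∷ xs} {ys} (x∉xs ∷ unique) xs⊆ys with ∈-∃++ (xs⊆ys (here refl))
... | as , bs , refl = ≤-trans (s≤s (unique-length-≤ unique xs⊆as++bs)) (≤-reflexive length-≡)
  where
  xs⊆as++bs : ∀ {y} → y ∈ xs → y ∈ as ++ bs
  xs⊆as++bs {y} y∈xs with ∈-++⁻ as (xs⊆ys (there y∈xs))
  ... | inj₁ y∈as = ∈-++⁺ˡ y∈as
  ... | inj₂ (here refl) = contradiction refl (All.lookup x∉xs y∈xs)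
  ... | inj₂ (there y∈bs) = ∈-++⁺ʳ as y∈bs
  length-≡ : suc (length (as ++ bs)) ≡ length (as ++ x ∷ bs)
  length-≡ rewrite length-++ as {bs} | length-++ as {x ∷ bs} = ≡.sym (+-suc (length as) (length bs))

allMaps-cartesian : ∀ k c → allMaps (suc k) c ≡ cartesianProductWith _∷_ (allFin c) (allMaps k c)
allMaps-cartesian k c = go (allFin c)
  where
  go : ∀ xs → concatMap (λ x → map (x ∷_) (allMaps k c)) xs
             ≡ cartesianProductWith _∷_ xs (allMaps k c)
  go [] = refl
  go (x ∷ xs) = cong (map (x ∷_) (allMaps k c) ++_) (go xs)

∈-allMaps : ∀ k c (v : Vec (Fin c) k) → v ∈ allMaps k c
∈-allMaps zero c [] = here refl
∈-allMaps (suc k) c (x ∷ v) = subst (x ∷ v ∈_) (≡.sym (allMaps-cartesian k c))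
  (∈-cartesianProductWith⁺ _∷_ (∈-allFin x) (∈-allMaps k c v))

allMaps-unique : ∀ k c → Unique (allMaps k c)
allMaps-unique zero c = [] ∷ []
allMaps-unique (suc k) c = subst Unique (≡.sym (allMaps-cartesian k c))
  (Unique.cartesianProductWith⁺ _∷_ ∷-injective (Unique.allFin⁺ c) (allMaps-unique k c))

filter-allMaps-≤ : ∀ {k k′ c} (P : Vec (Fin c) k → Bool) (Q : Vec (Fin c) k′ → Bool)
                   (Φ : Vec (Fin c) k → Vec (Fin c) k′) →
                   (∀ {f g} → Φ f ≡ Φ g → f ≡ g) → (∀ f → T (P f) → T (Q (Φ f))) →
                   length (filterᵇ P (allMaps k c)) ≤ length (filterᵇ Q (allMaps k′ c))
filter-allMaps-≤ {k} {k′} {c} P Q Φ Φ-injective P⇒Q =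
  ≤-trans (≤-reflexive (≡.sym (length-map Φ Ps)))
          (unique-length-≤ (Unique.map⁺ Φ-injective (Unique.filter⁺ (T? ∘ P) (allMaps-unique k c)))
                           image⊆Qs)
  where
  Ps : List (Vec (Fin c) k)
  Ps = filterᵇ P (allMaps k c)
  image⊆Qs : ∀ {g} → g ∈ map Φ Ps → g ∈ filterᵇ Q (allMaps k′ c)
  image⊆Qs g∈ with ∈-map⁻ Φ g∈
  ... | f , f∈Ps , refl =
    ∈-filter⁺ (T? ∘ Q) (∈-allMaps k′ c (Φ f))
      (P⇒Q f (proj₂ (∈-filter⁻ (T? ∘ P) {xs = allMaps k c} f∈Ps)))

≈-sym : ∀ {G H} → G ≈ H → H ≈ G
≈-sym {G} {H} E = record
  { XG = XH ; XH = XG ; bipG = bipH ; bipH = bipG ; smallG = smallH ; smallH = smallG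
  ; sameX = ≡.sym sameX ; sameY = ≡.sym sameY
  ; η = η⁻¹
  ; η-into = λ T T⊆XH → proj₁ (η⁻¹-spec T T⊆XH)
  ; η-inj = λ S T S⊆XH T⊆XH eq →
      trans (≡.sym (proj₂ (η⁻¹-spec S S⊆XH))) (trans (cong η eq) (proj₂ (η⁻¹-spec T T⊆XH)))
  ; η-surj = λ S S⊆XG → η S , η-into S S⊆XG , η⁻¹∘η S S⊆XG
  ; η-size = λ T T⊆XH →
      trans (≡.sym (η-size (η⁻¹ T) (proj₁ (η⁻¹-spec T T⊆XH))))
            (cong ∣_∣ (proj₂ (η⁻¹-spec T T⊆XH)))
  ; η-nbhd = λ T T⊆XH →
      trans (≡.sym (η-nbhd (η⁻¹ T) (proj₁ (η⁻¹-spec T T⊆XH))))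
            (cong (∣_∣ ∘ N H) (proj₂ (η⁻¹-spec T T⊆XH)))
  }
  where
  open NSEquiv E
  η⁻¹ : Subset (n H) → Subset (n G)
  η⁻¹ T with T ⊆? XH
  ... | yes T⊆XH = proj₁ (η-surj T T⊆XH)
  ... | no _ = XG
  η⁻¹-spec : ∀ T → T ⊆ XH → η⁻¹ T ⊆ XG × η (η⁻¹ T) ≡ T
  η⁻¹-spec T T⊆XH with T ⊆? XH
  ... | yes T⊆XH′ = proj₂ (η-surj T T⊆XH′)
  ... | no T⊈XH = ⊥-elim (T⊈XH T⊆XH)
  η⁻¹∘η : ∀ S → S ⊆ XG → η⁻¹ (η S) ≡ S
  η⁻¹∘η S S⊆XG = let ηS⊆XH = η-into S S⊆XG in
    η-inj _ S (proj₁ (η⁻¹-spec (η S) ηS⊆XH)) S⊆XG (proj₂ (η⁻¹-spec (η S) ηS⊆XH))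

module Comparison {G H : Graph} (E : G ≈ H) (p q : ℕ) where
  open NSEquiv E

  Colouring : Graph → Set
  Colouring K = Vec (Fin (p + q + 2)) (n K)

  roles : Vec (Fin (p + q + 2)) k → Fin k → Role
  roles f i = role p (lookup f i)

  R : Colouring G → Subset (n G)
  R f = leaves XG (roles f)

  R⊆XG : ∀ f → R f ⊆ XG
  R⊆XG f = leaves⊆ XG (roles f)

  regionsG : Subset (n G) → Vec (Bool × Bool) (n G)
  regionsG S = regions XG S (N G S)

  regionsH : Subset (n H) → Vec (Bool × Bool) (n H)
  regionsH T = regions XH T (N H T)

  same-counts : ∀ S → S ⊆ XG → ∀ l → count l (regionsG S) ≡ count l (regionsH (η S))
  same-counts S S⊆XG l = begin
    count l (regionsG S)               ≡⟨ count-regions XG S (N G S) S⊆XG (N⊆∁ G bipG S⊆XG) l ⟩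
    regionSize XG S (N G S) l          ≡⟨ same-size l ⟩
    regionSize XH (η S) (N H (η S)) l  ≡⟨ count-regions XH (η S) (N H (η S)) ηS⊆XH (N⊆∁ H bipH ηS⊆XH) l ⟨
    count l (regionsH (η S))           ∎
    where
    open ≡.≡-Reasoning
    ηS⊆XH : η S ⊆ XH
    ηS⊆XH = η-into S S⊆XG
    same-size : ∀ l → regionSize XG S (N G S) l ≡ regionSize XH (η S) (N H (η S)) l
    same-size (true , true) = ≡.sym (η-size S S⊆XG)
    same-size (true , false) = cong₂ _∸_ sameX (≡.sym (η-size S S⊆XG))
    same-size (false , true) = ≡.sym (η-nbhd S S⊆XG)
    same-size (false , false) = cong₂ _∸_ sameY (≡.sym (η-nbhd S S⊆XG))

  anyVertex : Fin (p + q + 2)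
  anyVertex = p + q ↑ʳ zero

  transfer : Subset (n G) → Colouring G → Colouring H
  transfer S = relabel anyVertex (regionsG S) (regionsH (η S))

  Φ : Colouring G → Colouring H
  Φ f = transfer (R f) f

  module _ (f : Colouring G) where

    private
      same-counts-R : ∀ l → count l (regionsG (R f)) ≡ count l (regionsH (η (R f)))
      same-counts-R = same-counts (R f) (R⊆XG f)

    Φ-from : ∀ j → ∃ λ i → lookup (regionsG (R f)) i ≡ lookup (regionsH (η (R f))) j ×
                           lookup f i ≡ lookup (Φ f) j
    Φ-from = relabel-from anyVertex (regionsG (R f)) (regionsH (η (R f))) same-counts-R f

    Φ-onto : ∀ i → ∃ λ j → lookup (regionsH (η (R f))) j ≡ lookup (regionsG (R f)) i ×
                           lookup (Φ f) j ≡ lookup f i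
    Φ-onto = relabel-onto anyVertex (regionsG (R f)) (regionsH (η (R f))) same-counts-R f

    Φ-injectiveʳ : ∀ {f′} → transfer (R f) f ≡ transfer (R f) f′ → f ≡ f′
    Φ-injectiveʳ = relabel-injective anyVertex (regionsG (R f)) (regionsH (η (R f))) same-counts-R

  leaves-Φ : ∀ f → leaves XH (roles (Φ f)) ≡ η (R f)
  leaves-Φ f = trans (tabulate-cong pointwise) (tabulate∘lookup (η (R f)))
    where
    pointwise : ∀ j → lookup XH j ∧ isLeaf (roles (Φ f) j) ≡ lookup (η (R f)) j
    pointwise j with lookup XH j in XHj
    ... | false = ≡.sym (⊆-outside (η-into (R f) (R⊆XG f)) XHj)
    ... | true =
      let i , same-region , same-value = Φ-from f j
          XGi , Ri≡ηRj = regions-true⁻ XG (R f) (N G (R f))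
                           (trans same-region (regions-inside XH (η (R f)) (N H (η (R f))) XHj))
      in begin
        isLeaf (roles (Φ f) j)   ≡⟨ cong (isLeaf ∘ role p) (≡.sym same-value) ⟩
        isLeaf (roles f i)       ≡⟨ leaves-inside XG (roles f) XGi ⟨
        lookup (R f) i           ≡⟨ Ri≡ηRj ⟩
        lookup (η (R f)) j       ∎
      where open ≡.≡-Reasoning

  Φ-injective : ∀ {f f′} → Φ f ≡ Φ f′ → f ≡ f′
  Φ-injective {f} {f′} eq = Φ-injectiveʳ f (trans eq (cong (λ S → transfer S f′) (≡.sym same-R)))
    where
    same-R : R f ≡ R f′
    same-R = η-inj (R f) (R f′) (R⊆XG f) (R⊆XG f′)
      (trans (≡.sym (leaves-Φ f)) (trans (cong (leaves XH ∘ roles) eq) (leaves-Φ f′)))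

  Φ-surj : ∀ f → IsSurj f → IsSurj (Φ f)
  Φ-surj f onto b =
    let i , fi≡b = onto b
        j , _ , Φfj≡fi = Φ-onto f i
    in j , trans Φfj≡fi fi≡b

  Φ-hom : Connected G → Fin (n G) → ∀ f → IsHom G (Badj p q) f → IsHom H (Badj p q) (Φ f)
  Φ-hom connected i₀ f hom j j′ jj′ =
    trans (Badj-role p q (lookup (Φ f) j) (lookup (Φ f) j′))
          (fits⇒roleHom H XH bipH c (η (R f)) (roles (Φ f)) fitsH j j′ jj′)
    where
    ρ-hom : IsRoleHom G (roles f)
    ρ-hom i i′ ii′ = trans (≡.sym (Badj-role p q (lookup f i) (lookup f i′))) (hom i i′ ii′)
    c : Bool
    c = lookup XG i₀ xor side (roles f i₀)
    parity : ∀ i → lookup XG i xor side (roles f i) ≡ c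
    parity i = ≡.sym (parity-along G XG bipG (roles f) ρ-hom (connected i₀ i))
    fitsH : ∀ j → Fits c (lookup (regionsH (η (R f))) j) (roles (Φ f) j)
    fitsH j = let i , same-region , same-value = Φ-from f j in
      subst₂ (Fits c) same-region (cong (role p) same-value) (leaves-fit G XG bipG (roles f) ρ-hom c parity i)

  Φ-isHom : Connected G → Fin (n G) → ∀ f → T (isHom G (Badj p q) f) → T (isHom H (Badj p q) (Φ f))
  Φ-isHom connected i₀ f t = isHom⁺ H (Badj p q) (Φ f) (Φ-hom connected i₀ f (isHom⁻ G (Badj p q) f t))

  Φ-isSurj : ∀ f → T (isSurj f) → T (isSurj (Φ f))
  Φ-isSurj f t = isSurj⁺ (Φ f) (Φ-surj f (isSurj⁻ f t))

hom-count-≤ : ∀ {G H} → G ≈ H → Connected G → Fin (n G) → ∀ p q → homCountB G p q ≤ homCountB H p q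
hom-count-≤ {G} {H} E connected i₀ p q =
  filter-allMaps-≤ (isHom G (Badj p q)) (isHom H (Badj p q)) Φ Φ-injective (Φ-isHom connected i₀)
  where open Comparison E p q

surjHom-count-≤ : ∀ {G H} → G ≈ H → Connected G → Fin (n G) → ∀ p q →
                  surjHomCountB G p q ≤ surjHomCountB H p q
surjHom-count-≤ {G} {H} E connected i₀ p q =
  filter-allMaps-≤ (λ f → isHom G (Badj p q) f ∧ isSurj f) (λ g → isHom H (Badj p q) g ∧ isSurj g)
    Φ Φ-injective preserved
  where
  open Comparison E p q
  preserved : ∀ f → T (isHom G (Badj p q) f ∧ isSurj f) → T (isHom H (Badj p q) (Φ f) ∧ isSurj (Φ f))
  preserved f t = let hom , surj = Equivalence.to T-∧ t in
    Equivalence.from T-∧ (Φ-isHom connected i₀ f hom , Φ-isSurj f surj)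

lemma11 : (G H : Graph) → n G ≥ 2 → n H ≥ 2 → Connected G → Connected H → G ≈ H →
          (p q : ℕ) → p ≥ 1 → q ≥ 1 →
          (homCountB G p q ≡ homCountB H p q) × (surjHomCountB G p q ≡ surjHomCountB H p q)
lemma11 G H nG≥2 nH≥2 connectedG connectedH G≈H p q _ _ =
  ≤-antisym (hom-count-≤ G≈H connectedG i₀ p q) (hom-count-≤ H≈G connectedH j₀ p q) ,
  ≤-antisym (surjHom-count-≤ G≈H connectedG i₀ p q) (surjHom-count-≤ H≈G connectedH j₀ p q)
  where
  H≈G : H ≈ G
  H≈G = ≈-sym G≈H
  i₀ : Fin (n G)
  i₀ = fromℕ< nG≥2
  j₀ : Fin (n H)
  j₀ = fromℕ< nH≥2
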